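{- Let $p>5$ be a prime and $k$ a positive integer with $k<p/4$. Set $D=\left\lceil \frac{2kp}{p-3}\right\rceil$; then $D<p$, and for any $D$-APs $A_1,\dots,A_k\subseteq\mathbb{Z}_p$ we have $\big|\sum_{i=1}^k A_i\big| \le \frac{p-1}{2}$.
   Context: $\mathbb{Z}_p=\{0,\dots,p-1\}$ under addition modulo $p$. The sumset is $\sum_{i=1}^k A_i = \{a_1+\dots+a_k \bmod p : a_i\in A_i\}$. For $b\in\{0,\dots,D-1\}$, the $D$-AP in $\mathbb{Z}_p$ with base $b$ is $A_{(b)} = \{b+iD : i\ge 0,\ b+iD<p\}$; a $D$-AP is a set of this form. -}

module Defs where

open import Data.Nat using (ℕ; zero; suc; _+_; _*_; _≡ᵇ_)
open import Data.Nat.DivMod using (_/_)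
open import Data.Bool using (Bool; _∧_; _∨_)
open import Data.Fin using (Fin; toℕ)
open import Data.Fin.Subset using (Subset)
open import Data.Vec using (Vec; []; _∷_; tabulate; lookup; map)
open import Data.List using (allFin)
open import Data.Bool.ListAction using (any)

-- Ceiling division ⌈ m / d ⌉ ; the value for d = 0 is an irrelevant junk value.
⌈_/_⌉ : ℕ → ℕ → ℕ
⌈ m / zero ⌉ = 0
⌈ m / suc d ⌉ = (m + d) / suc d

-- Z_n is represented by Fin n, subsets of Z_n by Subset n (Vec Bool n).

-- The D-AP in Z_n with base b : { b + i D : i ≥ 0, b + i D < n }.
-- (x ∈ AP iff x = b + i*D for some i; i < n suffices since x < n.)
AP : (n D b : ℕ) → Subset n
AP n D b = tabulate λ x → any (λ i → (b + toℕ i * D) ≡ᵇ toℕ x) (allFin n)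

-- Sumset A + B in Z_n : x ∈ A + B iff x ≡ a + b (mod n) for some a ∈ A, b ∈ B.
-- Since a, b, x < n, a + b ≡ x (mod n) iff a + b = x or a + b = x + n.
_⊕_ : ∀ {n} → Subset n → Subset n → Subset n
_⊕_ {n} A B = tabulate λ x →
  any (λ a → lookup A a ∧
    any (λ b → lookup B b ∧
      (((toℕ a + toℕ b) ≡ᵇ toℕ x) ∨ ((toℕ a + toℕ b) ≡ᵇ (toℕ x + n))))
      (allFin n))
    (allFin n)

-- The singleton {0} in Z_n (neutral element for ⊕), empty if n = 0.
zeroSet : ∀ n → Subset n
zeroSet n = tabulate λ x → toℕ x ≡ᵇ 0

sumset : ∀ {n k} → Vec (Subset n) k → Subset n
sumset {n} [] = zeroSet n
sumset (A ∷ As) = A ⊕ sumset As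

-- Every element of A_{(b_1)} + ⋯ + A_{(b_k)} is the residue of B + m D, where B = b_1 + ⋯ + b_k and
-- m is a sum of k progression indices; lifting each summand to ℕ below p gives B + m D ≤ k (p − 1).
-- Hence m D ≤ k (p − 1), and since D (p − 3) ≥ 2 k p this forces 2 m < p − 2, i.e. m < ⌊(p − 1)/2⌋.
-- So the sumset is the image of at most ⌊(p − 1)/2⌋ values of m under m ↦ B + m D mod p.
module Submission where

open import Defs
open import Data.Nat using (ℕ; zero; suc; _+_; _*_; _∸_; _≤_; _<_; z≤n; s≤s; _≡ᵇ_; NonZero; >-nonZero)
open import Data.Nat.DivMod
  using (_/_; _%_; _mod_; m≡m%n+[m/n]*n; m%n<n; [m+kn]%n≡m%n; m<n⇒m%n≡m; m<n*o⇒m/o<n; m*n/n≡m; /-monoˡ-≤)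
open import Data.Nat.Primality using (Prime)
open import Data.Fin using (Fin; toℕ)
open import Data.Fin.Subset using (∣_∣; Subset; _∈_; _⊆_; _∪_; ⁅_⁆; ⊥; inside; outside)
open import Data.Vec using (Vec; map; []; _∷_; lookup; tabulate; sum)
open import Data.Product using (_×_; ∃; ∃₂; _,_)

open import Data.Nat.Properties
open import Data.Nat.Tactic.RingSolver using (solve-∀; solve)
open import Data.Fin.Properties using (toℕ<n; toℕ≤pred[n]; toℕ-injective; toℕ-fromℕ<)
open import Data.Fin.Subset.Properties using (p⊆q⇒∣p∣≤∣q∣; ∣⊥∣≡0; ∣⁅x⁆∣≡1; x∈⁅x⁆; x∈p∪q⁺)
open import Data.Bool using (Bool; T)
open import Data.Bool.Properties using (T-≡; T-∧; T-∨)
open import Data.Bool.ListAction using (any)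
open import Data.List as List using (List; allFin)
open import Data.List.Relation.Unary.Any using (satisfied)
open import Data.List.Relation.Unary.Any.Properties using (any⇔)
open import Data.Vec.Properties using (lookup∘tabulate; []=⇒lookup; lookup⇒[]=; map-∘)
open import Data.Sum using (_⊎_; inj₁; inj₂)
open import Function using (_∘_; Equivalence)
open import Relation.Binary.PropositionalEquality

private
  variable
    n : ℕ

T-any⁻ : ∀ {A : Set} (f : A → Bool) (xs : List A) → T (any f xs) → ∃ (T ∘ f)
T-any⁻ f xs = satisfied ∘ Equivalence.from (any⇔ {xs = xs})

T-lookup⇒∈ : ∀ {A : Subset n} {x} → T (lookup A x) → x ∈ A
T-lookup⇒∈ {A = A} {x} = lookup⇒[]= x A ∘ Equivalence.to T-≡

∈-tabulate⁻ : ∀ (f : Fin n → Bool) {x} → x ∈ tabulate f → T (f x)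
∈-tabulate⁻ f {x} x∈ =
  Equivalence.from T-≡ (trans (sym (lookup∘tabulate f x)) ([]=⇒lookup x∈))

∈zeroSet⁻ : ∀ {x : Fin n} → x ∈ zeroSet n → toℕ x ≡ 0
∈zeroSet⁻ {x = x} = ≡ᵇ⇒≡ (toℕ x) 0 ∘ ∈-tabulate⁻ _

∈AP⁻ : ∀ D b {x : Fin n} → x ∈ AP n D b → ∃ λ (i : Fin n) → b + toℕ i * D ≡ toℕ x
∈AP⁻ {n} D b {x} x∈ with T-any⁻ _ (allFin n) (∈-tabulate⁻ _ x∈)
... | i , eq = i , ≡ᵇ⇒≡ (b + toℕ i * D) (toℕ x) eq

∈⊕⁻ : ∀ (A B : Subset n) {x} → x ∈ A ⊕ B →
  ∃₂ λ a c → a ∈ A × c ∈ B × (toℕ a + toℕ c ≡ toℕ x ⊎ toℕ a + toℕ c ≡ toℕ x + n)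
∈⊕⁻ {n} A B {x} x∈ with T-any⁻ _ (allFin n) (∈-tabulate⁻ _ x∈)
... | a , a∈∧ with Equivalence.to T-∧ a∈∧
... | a∈ , any-c with T-any⁻ _ (allFin n) any-c
... | c , c∈∧ with Equivalence.to T-∧ c∈∧
... | c∈ , sum≡ = a , c , T-lookup⇒∈ a∈ , T-lookup⇒∈ c∈ , reflect (Equivalence.to T-∨ sum≡)
  where
  s = toℕ a + toℕ c
  reflect : T (s ≡ᵇ toℕ x) ⊎ T (s ≡ᵇ toℕ x + n) → s ≡ toℕ x ⊎ s ≡ toℕ x + n
  reflect (inj₁ e) = inj₁ (≡ᵇ⇒≡ s (toℕ x) e)
  reflect (inj₂ e) = inj₂ (≡ᵇ⇒≡ s (toℕ x + n) e)

record Lift (n D B k : ℕ) (x : Fin n) : Set where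
  constructor mkLift
  field
    steps wraps : ℕ
    bounded : B + steps * D ≤ k * (n ∸ 1)
    lifts : B + steps * D ≡ toℕ x + wraps * n

add-carry : ∀ a c {x} q → a + c ≡ x ⊎ a + c ≡ x + n → ∃ λ w → a + c + q * n ≡ x + w * n
add-carry a c q (inj₁ refl) = q , refl
add-carry {n} a c {x} q (inj₂ e) = suc q , trans (cong (_+ q * n) e) (+-assoc x n (q * n))

regroup : ∀ b B i m D → b + B + (i + m) * D ≡ (b + i * D) + (B + m * D)
regroup = solve-∀

sumset-APs-lift : ∀ {D k} (bs : Vec ℕ k) {x : Fin n} →
  x ∈ sumset (map (AP n D) bs) → Lift n D (sum bs) k x
sumset-APs-lift [] x∈ = mkLift 0 0 z≤n (sym (trans (+-identityʳ _) (∈zeroSet⁻ x∈)))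
sumset-APs-lift {n} {D} {suc k} (b ∷ bs) {x} x∈
  with ∈⊕⁻ (AP n D b) (sumset (map (AP n D) bs)) x∈
... | a , c , a∈ , c∈ , a+c with ∈AP⁻ D b a∈ | sumset-APs-lift bs c∈
... | i , b+iD≡a | mkLift m q bounded lifts with add-carry (toℕ a) (toℕ c) q a+c
... | w , carried = mkLift (toℕ i + m) w bound lifted
  where
  L = b + sum bs + (toℕ i + m) * D

  split : L ≡ toℕ a + (sum bs + m * D)
  split = trans (regroup b (sum bs) (toℕ i) m D) (cong (_+ (sum bs + m * D)) b+iD≡a)

  bound : L ≤ suc k * (n ∸ 1)
  bound = begin
    L                         ≡⟨ split ⟩
    toℕ a + (sum bs + m * D)  ≤⟨ +-mono-≤ (toℕ≤pred[n] a) bounded ⟩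
    (n ∸ 1) + k * (n ∸ 1)     ∎
    where open ≤-Reasoning

  lifted : L ≡ toℕ x + w * n
  lifted = begin
    L                         ≡⟨ split ⟩
    toℕ a + (sum bs + m * D)  ≡⟨ cong (toℕ a +_) lifts ⟩
    toℕ a + (toℕ c + q * n)   ≡⟨ +-assoc (toℕ a) (toℕ c) (q * n) ⟨
    toℕ a + toℕ c + q * n     ≡⟨ carried ⟩
    toℕ x + w * n             ∎
    where open ≡-Reasoning

∣p∪q∣≤∣p∣+∣q∣ : ∀ (p q : Subset n) → ∣ p ∪ q ∣ ≤ ∣ p ∣ + ∣ q ∣
∣p∪q∣≤∣p∣+∣q∣ []            []            = z≤n
∣p∪q∣≤∣p∣+∣q∣ (inside ∷ p)  (inside ∷ q)  = s≤s (≤-trans (∣p∪q∣≤∣p∣+∣q∣ p q) (+-monoʳ-≤ ∣ p ∣ (n≤1+n ∣ q ∣)))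
∣p∪q∣≤∣p∣+∣q∣ (inside ∷ p)  (outside ∷ q) = s≤s (∣p∪q∣≤∣p∣+∣q∣ p q)
∣p∪q∣≤∣p∣+∣q∣ (outside ∷ p) (inside ∷ q)  = ≤-trans (s≤s (∣p∪q∣≤∣p∣+∣q∣ p q)) (≤-reflexive (sym (+-suc ∣ p ∣ ∣ q ∣)))
∣p∪q∣≤∣p∣+∣q∣ (outside ∷ p) (outside ∷ q) = ∣p∪q∣≤∣p∣+∣q∣ p q

image : (ℕ → Fin n) → ℕ → Subset n
image f zero    = ⊥
image f (suc N) = ⁅ f N ⁆ ∪ image f N

∣image∣≤ : ∀ (f : ℕ → Fin n) N → ∣ image f N ∣ ≤ N
∣image∣≤ {n} f zero = ≤-reflexive (∣⊥∣≡0 n)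
∣image∣≤ f (suc N) = ≤-trans (∣p∪q∣≤∣p∣+∣q∣ ⁅ f N ⁆ (image f N))
  (+-mono-≤ (≤-reflexive (∣⁅x⁆∣≡1 (f N))) (∣image∣≤ f N))

∈image : ∀ (f : ℕ → Fin n) {m N} → m < N → f m ∈ image f N
∈image f {m} {suc N} m<1+N with m<1+n⇒m<n∨m≡n m<1+N
... | inj₁ m<N  = x∈p∪q⁺ (inj₂ (∈image f m<N))
... | inj₂ refl = x∈p∪q⁺ (inj₁ (x∈⁅x⁆ (f m)))

mod-lift : ∀ .{{_ : NonZero n}} {y q} {x : Fin n} → y ≡ toℕ x + q * n → y mod n ≡ x
mod-lift {n} {y} {q} {x} eq = toℕ-injective (begin
  toℕ (y mod n)        ≡⟨ toℕ-fromℕ< (m%n<n y n) ⟩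
  y % n                ≡⟨ cong (_% n) eq ⟩
  (toℕ x + q * n) % n  ≡⟨ [m+kn]%n≡m%n (toℕ x) q n ⟩
  toℕ x % n            ≡⟨ m<n⇒m%n≡m (toℕ<n x) ⟩
  toℕ x                ∎)
  where open ≡-Reasoning

∣sumset-APs∣≤ : ∀ {D k} .{{_ : NonZero n}} (bs : Vec ℕ k) h →
  (∀ m → m * D ≤ k * (n ∸ 1) → m < h) → ∣ sumset (map (AP n D) bs) ∣ ≤ h
∣sumset-APs∣≤ {n} {D} bs h steps<h = ≤-trans (p⊆q⇒∣p∣≤∣q∣ ⊆image) (∣image∣≤ residue h)
  where
  residue : ℕ → Fin n
  residue m = (sum bs + m * D) mod n
  ⊆image : sumset (map (AP n D) bs) ⊆ image residue h
  ⊆image x∈ with sumset-APs-lift bs x∈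
  ... | mkLift m q bounded lifts = subst (_∈ image residue h) (mod-lift {q = q} lifts)
    (∈image residue (steps<h m (≤-trans (m≤n+m (m * D) (sum bs)) bounded)))

m≤⌈m/n⌉*n : ∀ m d → m ≤ ⌈ m / suc d ⌉ * suc d
m≤⌈m/n⌉*n m d = +-cancelʳ-≤ d m (q * suc d) (begin
  m + d                        ≡⟨ m≡m%n+[m/n]*n (m + d) (suc d) ⟩
  (m + d) % suc d + q * suc d  ≤⟨ +-monoˡ-≤ (q * suc d) (≤-pred (m%n<n (m + d) (suc d))) ⟩
  d + q * suc d                ≡⟨ +-comm d (q * suc d) ⟩
  q * suc d + d                ∎)
  where
  open ≤-Reasoning
  q = (m + d) / suc d

m+n≤o*n⇒⌈m/n⌉<o : ∀ m d o → m + suc d ≤ o * suc d → ⌈ m / suc d ⌉ < o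
m+n≤o*n⇒⌈m/n⌉<o m d o le = m<n*o⇒m/o<n (≤-trans (≤-reflexive (sym (+-suc m d))) le)

-- Writing p = 6 + r makes p ∸ 3 = 3 + r a successor, so that ⌈_/_⌉ computes.
⌈2kp/[p-3]⌉<p : ∀ r k → 4 * k < 6 + r → ⌈ 2 * k * (6 + r) / (3 + r) ⌉ < 6 + r
⌈2kp/[p-3]⌉<p r k 4k<p = m+n≤o*n⇒⌈m/n⌉<o (2 * k * (6 + r)) (2 + r) (6 + r) (*-cancelˡ-≤ 2 doubled)
  where
  open ≤-Reasoning
  doubled : 2 * (2 * k * (6 + r) + (3 + r)) ≤ 2 * ((6 + r) * (3 + r))
  doubled = begin
    2 * (2 * k * (6 + r) + (3 + r))                   ≡⟨ solve (k List.∷ r List.∷ List.[]) ⟩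
    4 * k * (6 + r) + 2 * (3 + r)                     ≤⟨ +-monoˡ-≤ (2 * (3 + r)) (*-monoˡ-≤ (6 + r) (≤-pred 4k<p)) ⟩
    (5 + r) * (6 + r) + 2 * (3 + r)                   ≤⟨ m≤m+n ((5 + r) * (6 + r) + 2 * (3 + r)) (r * r + 5 * r) ⟩
    (5 + r) * (6 + r) + 2 * (3 + r) + (r * r + 5 * r) ≡⟨ solve (r List.∷ List.[]) ⟩
    2 * ((6 + r) * (3 + r))                           ∎

2*m<n⇒m<[1+n]/2 : ∀ m n → 2 * m < n → m < suc n / 2
2*m<n⇒m<[1+n]/2 m n 2m<n = begin
  suc m          ≡⟨ m*n/n≡m (suc m) 2 ⟨
  suc m * 2 / 2  ≤⟨ /-monoˡ-≤ 2 (s≤s (subst (_< n) (*-comm 2 m) 2m<n)) ⟩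
  suc n / 2      ∎
  where open ≤-Reasoning

m*⌈2kp/[p-3]⌉≤k[p-1]⇒m<[p-1]/2 : ∀ r k m → 1 ≤ k →
  m * ⌈ 2 * k * (6 + r) / (3 + r) ⌉ ≤ k * (5 + r) → m < (5 + r) / 2
m*⌈2kp/[p-3]⌉≤k[p-1]⇒m<[p-1]/2 r k m 1≤k mD≤ =
  2*m<n⇒m<[1+n]/2 m (4 + r) (*-cancelʳ-< (6 + r) (2 * m) (4 + r) (begin-strict
  2 * m * (6 + r)                      ≤⟨ *-cancelˡ-≤ k {{>-nonZero 1≤k}} scaled ⟩
  (5 + r) * (3 + r)                    <⟨ m<m+n ((5 + r) * (3 + r)) (s≤s z≤n) ⟩
  (5 + r) * (3 + r) + suc (2 * r + 8)  ≡⟨ solve (r List.∷ List.[]) ⟩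
  (4 + r) * (6 + r)                    ∎))
  where
  open ≤-Reasoning
  D = ⌈ 2 * k * (6 + r) / (3 + r) ⌉
  scaled : k * (2 * m * (6 + r)) ≤ k * ((5 + r) * (3 + r))
  scaled = begin
    k * (2 * m * (6 + r))    ≡⟨ solve (k List.∷ m List.∷ r List.∷ List.[]) ⟩
    m * (2 * k * (6 + r))    ≤⟨ *-monoʳ-≤ m (m≤⌈m/n⌉*n (2 * k * (6 + r)) (2 + r)) ⟩
    m * (D * (3 + r))        ≡⟨ *-assoc m D (3 + r) ⟨
    m * D * (3 + r)          ≤⟨ *-monoˡ-≤ (3 + r) mD≤ ⟩
    k * (5 + r) * (3 + r)    ≡⟨ *-assoc k (5 + r) (3 + r) ⟩
    k * ((5 + r) * (3 + r))  ∎

lemma11 : (p k : ℕ) → Prime p → 5 < p → 1 ≤ k → 4 * k < p →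
    let D = ⌈ 2 * k * p / (p ∸ 3) ⌉ in
    D < p ×
    ((bs : Vec (Fin D) k) →
    ∣ sumset (map (λ b → AP p D (toℕ b)) bs) ∣ ≤ (p ∸ 1) / 2)
lemma11 p k _ 5<p 1≤k 4k<p with m≤n⇒∃[o]m+o≡n 5<p
... | r , refl = ⌈2kp/[p-3]⌉<p r k 4k<p , λ bs →
  subst (λ As → ∣ sumset As ∣ ≤ (5 + r) / 2) (sym (map-∘ (AP p D) toℕ bs))
    (∣sumset-APs∣≤ (map toℕ bs) ((5 + r) / 2) (λ m → m*⌈2kp/[p-3]⌉≤k[p-1]⇒m<[p-1]/2 r k m 1≤k))
  where D = ⌈ 2 * k * p / (p ∸ 3) ⌉
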